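{- Let $\alpha\in\mathbb Z\setminus\{ -1,0\}$ and let $(h_n)$ be the sequence with $h_0=0$, $h_1=1$, $h_2=-\alpha(\alpha+1)$, $h_3=-\alpha^3(\alpha+1)^3$, $h_4=\alpha^6(\alpha+1)^5$, and for $m\ge2$: $h_{2m+1}=h_{m+2}h_m^3-h_{m-1}h_{m+1}^3$, for $m\ge 3$: $h_{2m}=h_m\big(h_{m+2}h_{m-1}^2-h_{m-2}h_{m+1}^2\big)/h_2$. (i) If $n\equiv 2,3,9,10\pmod{12}$, then $h_n$ is not a square. (ii) If $n\equiv 2,5,7,11,13,16\pmod{18}$, then $h_n$ is not a cube.
   Context: The sequence defined is the elliptic divisibility sequence attached to the point $(0,0)$ of order $6$ on the Tate normal form curve with $b=\alpha+\alpha^2$, $c=\alpha$. Convention: an integer $m$ is called a square if $m=\pm\beta^2$ for some nonzero integer $\beta$, and a cube if $m=\beta^3$ for some nonzero integer $\beta$. -}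

module Defs where

open import Data.Nat as ℕ using (ℕ; zero; suc)
open import Data.Integer using (ℤ; +_; -[1+_]; +[1+_]; _+_; _-_; _*_; -_; _^_; _/_)
open import Data.Product using (Σ; _×_)
open import Relation.Binary.PropositionalEquality using (_≡_; _≢_)

-- The paper's quotient is exact; we use
-- stdlib integer division, with the (never-used, since h₂ ≠ 0 under the
-- hypotheses α ∉ {-1,0}) convention that division by 0 returns 0.
divBy : ℤ → ℤ → ℤ
divBy a (+ 0)      = + 0
divBy a (+[1+ n ]) = a / +[1+ n ]
divBy a (-[1+ n ]) = a / -[1+ n ]

-- Fuel-based definition of the recursion; the fuel only serves termination.
-- With fuel ≥ n + 1 it computes h_n (all recursive indices are < n).
module _ (α : ℤ) where

  h₂ h₃ h₄ : ℤ
  h₂ = - (α * (α + + 1))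
  h₃ = - ((α ^ 3) * ((α + + 1) ^ 3))
  h₄ = (α ^ 6) * ((α + + 1) ^ 5)

  hGo : ℕ → ℕ → ℤ
  hGo zero _ = + 0
  hGo (suc f) 0 = + 0
  hGo (suc f) 1 = + 1
  hGo (suc f) 2 = h₂
  hGo (suc f) 3 = h₃
  hGo (suc f) 4 = h₄
  hGo (suc f) n@(suc (suc (suc (suc (suc k))))) with n ℕ.% 2
  ... | 0 = let m = n ℕ./ 2 in
            divBy (hGo f m * ((hGo f (m ℕ.+ 2) * (hGo f (m ℕ.∸ 1) ^ 2))
                              - (hGo f (m ℕ.∸ 2) * (hGo f (m ℕ.+ 1) ^ 2))))
                  h₂
  ... | _ = let m = n ℕ./ 2 in
            (hGo f (m ℕ.+ 2) * (hGo f m ^ 3))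
              - (hGo f (m ℕ.∸ 1) * (hGo f (m ℕ.+ 1) ^ 3))

h : ℤ → ℕ → ℤ
h α n = hGo α (suc n) n

-- Paper's convention: m is a square if m = ±β² for some nonzero integer β.
IsSquare : ℤ → Set
IsSquare m = Σ ℤ λ β → (β ≢ + 0) × ((m ≡ β * β) Data.Sum.⊎ (m ≡ - (β * β)))
  where import Data.Sum

IsCube : ℤ → Set
IsCube m = Σ ℤ λ β → (β ≢ + 0) × (m ≡ β * β * β)

module Submission where

open import Defs
open import Data.Nat using (ℕ; _%_)
open import Data.Integer using (ℤ; +_; -[1+_])
open import Data.Product using (_×_; _,_)
open import Data.Sum using (_⊎_)
open import Function using (_∘_)
open import Relation.Nullary using (¬_)
open import Relation.Binary.PropositionalEquality using (_≡_; _≢_)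

-- Write B = α + 1.  The sequence has the explicit form
--     h_n = sgn(n mod 12) · α^E(n) · B^F(n),   E(n) = ⌊5n²/12⌋,  F(n) = ⌊n²/3⌋,
-- with a sign sgn ∈ {0, ±1} depending only on n mod 12 (module ExplicitFormula).  It is
-- proved by checking that the closed form satisfies the doubling formulas of Defs:
-- moving the index by a multiple of 12 multiplies every term by a monomial whose
-- exponents match on both sides, so only the twelve smallest cases of each formula
-- remain, and each of these becomes, after dividing out the common monomial, an
-- identity in α with exponents 0 and 1 that the ring solver decides.
--
-- Since |α| and |α + 1| are consecutive positive integers, |h_n| can only be a k-th
-- power if |α|^(E(n) mod k) · |α+1|^(F(n) mod k) is one (module PerfectPowers).  For the
-- residues in the theorem these reduced exponents are (1,1) when k = 2 and one of
-- (1,1), (1,2), (2,1) when k = 3 (module Obstructions, by tables modulo 12 and 36), and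
-- such products of consecutive integers are never squares resp. cubes: they lie strictly
-- between consecutive powers, or, for z(z+1), would split into two coprime cubes.

-- Perfect powers among products of powers of two consecutive integers.
module PerfectPowers where

  open import Data.Nat using (ℕ; zero; suc; _+_; _*_; _^_; _%_; _/_; _<_; z<s; NonZero; ≢-nonZero; ≢-nonZero⁻¹)
  open import Data.Nat.Properties
  open import Data.Nat.Divisibility using (_∣_; divides; ∣-refl; ∣-trans; ∣-antisym; ∣1⇒≡1; m∣m*n; n∣m*n; *-monoˡ-∣; *-cancelʳ-∣)
  open import Data.Nat.GCD using (gcd; gcd[m,n]∣m; gcd[m,n]∣n; gcd-greatest)
  open import Data.Nat.Coprimality as Coprime using (Coprime; coprime-divisor)
  open import Data.Nat.Tactic.RingSolver using (solve-∀)
  open import Algebra.Properties.CommutativeSemigroup *-commutativeSemigroup using (interchange)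
  open import Data.Product using (Σ-syntax; _×_; _,_)
  open import Data.Sum using (_⊎_; inj₁; inj₂)
  open import Data.Empty using (⊥)
  open import Function using (_∘_)
  open import Data.Nat.DivMod using (m≡m%n+[m/n]*n)
  open import Relation.Nullary using (¬_)
  open import Relation.Binary.PropositionalEquality

  IsPower : ℕ → ℕ → Set
  IsPower k x = Σ[ c ∈ ℕ ] x ≡ c ^ k

  ^-distribʳ-* : ∀ m n k → (m * n) ^ k ≡ m ^ k * n ^ k
  ^-distribʳ-* m n zero    = refl
  ^-distribʳ-* m n (suc k) = begin
    m * n * (m * n) ^ k      ≡⟨ cong (m * n *_) (^-distribʳ-* m n k) ⟩
    m * n * (m ^ k * n ^ k)  ≡⟨ interchange m n (m ^ k) (n ^ k) ⟩
    m ^ suc k * n ^ suc k    ∎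
    where open ≡-Reasoning

  coprime-*ˡ : ∀ {m w n} → Coprime m n → Coprime w n → Coprime (m * w) n
  coprime-*ˡ {m} cop-m cop-w {d} (d∣mw , d∣n) = cop-w (coprime-divisor d⊥m d∣mw , d∣n)
    where
    d⊥m : Coprime d m
    d⊥m (e∣d , e∣m) = cop-m (e∣m , ∣-trans e∣d d∣n)

  coprime-^ˡ : ∀ {m n} k → Coprime m n → Coprime (m ^ k) n
  coprime-^ˡ zero    _   = Coprime.1-coprimeTo _
  coprime-^ˡ (suc k) cop = coprime-*ˡ cop (coprime-^ˡ k cop)

  coprime-suc : ∀ z → Coprime z (suc z)
  coprime-suc z = Coprime.sym (subst (λ x → Coprime x z) (+-comm z 1) (Coprime.coprime-+ (Coprime.1-coprimeTo z)))

  record GcdSplit (d e : ℕ) : Set where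
    field
      g q q′   : ℕ
      .{{g≢0}} : NonZero g
      d≡qg     : d ≡ q * g
      e≡q′g    : e ≡ q′ * g
      q⊥q′     : Coprime q q′

  gcdSplit : ∀ d e .{{_ : NonZero d}} → GcdSplit d e
  gcdSplit d e with gcd[m,n]∣m d e | gcd[m,n]∣n d e
  ... | divides q d≡qg | divides q′ e≡q′g = record
    { g = gcd d e ; q = q ; q′ = q′ ; g≢0 = g≢0 ; d≡qg = d≡qg ; e≡q′g = e≡q′g ; q⊥q′ = q⊥q′ }
    where
    g≢0 : NonZero (gcd d e)
    g≢0 = ≢-nonZero λ g≡0 → ≢-nonZero⁻¹ d (trans d≡qg (trans (cong (q *_) g≡0) (*-zeroʳ q)))
    q⊥q′ : Coprime q q′
    q⊥q′ {i} (i∣q , i∣q′) = ∣1⇒≡1 (*-cancelʳ-∣ (gcd d e) {{g≢0}}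
      (subst (i * gcd d e ∣_) (sym (*-identityˡ (gcd d e)))
        (gcd-greatest (subst (i * gcd d e ∣_) (sym d≡qg) (*-monoˡ-∣ (gcd d e) i∣q))
                      (subst (i * gcd d e ∣_) (sym e≡q′g) (*-monoˡ-∣ (gcd d e) i∣q′)))))

  -- If d^(k+1) divides e^(k+1) then d divides e: with d = qg, e = q′g as above,
  -- q^(k+1) ∣ q′^(k+1) forces q = 1.
  power-∣⇒∣ : ∀ k d e .{{_ : NonZero d}} → d ^ suc k ∣ e ^ suc k → d ∣ e
  power-∣⇒∣ k d e dᵏ∣eᵏ with gcdSplit d e
  ... | record { g = g ; q = q ; q′ = q′ ; d≡qg = refl ; e≡q′g = refl ; q⊥q′ = q⊥q′ } =
    subst (_∣ q′ * g) (sym (trans (cong (_* g) q≡1) (*-identityˡ g))) (n∣m*n q′)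
    where
    qᵏ∣q′ᵏ : q ^ suc k ∣ q′ ^ suc k
    qᵏ∣q′ᵏ = *-cancelʳ-∣ (g ^ suc k) {{m^n≢0 g (suc k)}}
               (subst₂ _∣_ (^-distribʳ-* q g (suc k)) (^-distribʳ-* q′ g (suc k)) dᵏ∣eᵏ)
    q≡1 : q ≡ 1
    q≡1 = Coprime.sym (coprime-^ˡ (suc k) (Coprime.sym q⊥q′)) (∣-refl , ∣-trans (m∣m*n (q ^ k)) qᵏ∣q′ᵏ)

  power-cofactor : ∀ k x Q .{{_ : NonZero Q}} → IsPower (suc k) (x * Q ^ suc k) → IsPower (suc k) x
  power-cofactor k x Q (γ , xQᵏ≡γᵏ) with power-∣⇒∣ k Q γ (divides x (sym xQᵏ≡γᵏ))
  ... | divides c refl = c , *-cancelʳ-≡ x (c ^ suc k) (Q ^ suc k) {{m^n≢0 Q (suc k)}}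
                               (trans xQᵏ≡γᵏ (^-distribʳ-* c Q (suc k)))

  -- If a·b is a (k+1)-th power with a, b coprime and a ≠ 0, then a is a (k+1)-th
  -- power, namely of g = gcd a c: writing a = qg, c = q′g one finds q = g^k.
  coprime-product-power : ∀ k a b c .{{_ : NonZero a}} → Coprime a b → a * b ≡ c ^ suc k → IsPower (suc k) a
  coprime-product-power k a b c a⊥b ab≡cᵏ with gcdSplit a c
  ... | record { g = g ; q = q ; q′ = q′ ; d≡qg = refl ; e≡q′g = refl ; q⊥q′ = q⊥q′ } =
    g , trans (cong (_* g) (∣-antisym q∣gᵏ gᵏ∣q)) (*-comm (g ^ k) g)
    where
    open ≡-Reasoning
    qb≡q′ᵏgᵏ : q * b ≡ q′ ^ suc k * g ^ k
    qb≡q′ᵏgᵏ = *-cancelʳ-≡ (q * b) (q′ ^ suc k * g ^ k) g (begin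
      q * b * g                   ≡⟨ *-assoc q b g ⟩
      q * (b * g)                 ≡⟨ cong (q *_) (*-comm b g) ⟩
      q * (g * b)                 ≡⟨ *-assoc q g b ⟨
      q * g * b                   ≡⟨ ab≡cᵏ ⟩
      (q′ * g) ^ suc k            ≡⟨ ^-distribʳ-* q′ g (suc k) ⟩
      q′ ^ suc k * (g * g ^ k)    ≡⟨ cong (q′ ^ suc k *_) (*-comm g (g ^ k)) ⟩
      q′ ^ suc k * (g ^ k * g)    ≡⟨ *-assoc (q′ ^ suc k) (g ^ k) g ⟨
      q′ ^ suc k * g ^ k * g      ∎)
    q∣gᵏ : q ∣ g ^ k
    q∣gᵏ = coprime-divisor (Coprime.sym (coprime-^ˡ (suc k) (Coprime.sym q⊥q′)))
                           (divides b (trans (sym qb≡q′ᵏgᵏ) (*-comm q b)))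
    gᵏ⊥b : Coprime (g ^ k) b
    gᵏ⊥b = coprime-^ˡ k λ (e∣g , e∣b) → a⊥b (∣-trans e∣g (n∣m*n q) , e∣b)
    gᵏ∣q : g ^ k ∣ q
    gᵏ∣q = coprime-divisor gᵏ⊥b (divides (q′ ^ suc k) (trans (*-comm b q) qb≡q′ᵏgᵏ))

  no-power-between : ∀ k x c → x ^ k < c ^ k → c ^ k < suc x ^ k → ⊥
  no-power-between k x c xᵏ<cᵏ cᵏ<[1+x]ᵏ with ≤-<-connex c x
  ... | inj₁ c≤x = <⇒≱ xᵏ<cᵏ (^-monoˡ-≤ k c≤x)
  ... | inj₂ x<c = <⇒≱ cᵏ<[1+x]ᵏ (^-monoˡ-≤ k x<c)

  -- z(z+1) lies strictly between z² and (z+1)², so it is not a square.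
  consecutive-product-not-square : ∀ z .{{_ : NonZero z}} → ¬ IsPower 2 (z * suc z)
  consecutive-product-not-square z (c , z[1+z]≡c²) = no-power-between 2 z c
    (subst (z ^ 2 <_) z[1+z]≡c² (*-monoʳ-< z (subst (_< suc z) (sym (*-identityʳ z)) (n<1+n z))))
    (subst (_< suc z ^ 2) z[1+z]≡c² (subst (z * suc z <_) (cong (suc z *_) (sym (*-identityʳ (suc z))))
                                                        (*-monoˡ-< (suc z) (n<1+n z))))

  -- z(z+1)² lies strictly between z³ and (z+1)³.
  not-cube-z[1+z]² : ∀ z .{{_ : NonZero z}} → ¬ IsPower 3 (z * suc z ^ 2)
  not-cube-z[1+z]² z (c , eq) = no-power-between 3 z c
    (subst (z ^ 3 <_) eq (*-monoʳ-< z (^-monoˡ-< 2 (n<1+n z))))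
    (subst (_< suc z ^ 3) eq (*-monoˡ-< (suc z ^ 2) {{m^n≢0 (suc z) 2}} (n<1+n z)))

  -- z²(z+1) lies strictly between z³ and (z+1)³.
  not-cube-z²[1+z] : ∀ z .{{_ : NonZero z}} → ¬ IsPower 3 (z ^ 2 * suc z)
  not-cube-z²[1+z] z (c , eq) = no-power-between 3 z c
    (subst (z ^ 3 <_) eq (subst (_< z ^ 2 * suc z) (*-comm (z ^ 2) z) (*-monoʳ-< (z ^ 2) {{m^n≢0 z 2}} (n<1+n z))))
    (subst (_< suc z ^ 3) eq (subst (z ^ 2 * suc z <_) (*-comm (suc z ^ 2) (suc z)) (*-monoˡ-< (suc z) (^-monoˡ-< 2 (n<1+n z)))))

  -- The only consecutive cubes are 0 and 1: (u+1)³ > u³ + 1 for u ≥ 1.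
  consecutive-cubes : ∀ u v .{{_ : NonZero u}} → suc (u ^ 3) ≢ v ^ 3
  consecutive-cubes (suc w) v eq = no-power-between 3 (suc w) v
    (subst (suc w ^ 3 <_) eq (n<1+n (suc w ^ 3)))
    (subst (_< suc (suc w) ^ 3) eq (subst (suc (suc w ^ 3) <_) (sym (gap w)) (m<m+n (suc (suc w ^ 3)) z<s)))
    where
    gap : ∀ w → suc (suc w) * (suc (suc w) * (suc (suc w) * 1))
              ≡ suc (suc w * (suc w * (suc w * 1))) + suc (3 * (w * w) + 9 * w + 5)
    gap = solve-∀

  -- z(z+1) is not a cube: both coprime factors would be cubes.
  consecutive-product-not-cube : ∀ z .{{_ : NonZero z}} → ¬ IsPower 3 (z * suc z)
  consecutive-product-not-cube z (c , eq)
    with coprime-product-power 2 z (suc z) c (coprime-suc z) eq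
       | coprime-product-power 2 (suc z) z c (Coprime.sym (coprime-suc z)) (trans (*-comm (suc z) z) eq)
  ... | zero  , refl | _      = ≢-nonZero⁻¹ 0 refl
  ... | suc u , refl | v , eq′ = consecutive-cubes (suc u) v eq′

  -- Reducing the exponents of a^e·b^f modulo k + 1 divides it by a (k+1)-th power,
  -- so a (k+1)-th power stays one.
  power-reduce-exponents : ∀ k a b e f .{{_ : NonZero a}} .{{_ : NonZero b}} →
    IsPower (suc k) (a ^ e * b ^ f) → IsPower (suc k) (a ^ (e % suc k) * b ^ (f % suc k))
  power-reduce-exponents k a b e f = power-cofactor k _ Q {{Q≢0}} ∘ subst (IsPower (suc k)) split
    where
    open ≡-Reasoning
    n = suc k
    Q = a ^ (e / n) * b ^ (f / n)
    Q≢0 : NonZero Q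
    Q≢0 = m*n≢0 _ _ {{m^n≢0 a (e / n)}} {{m^n≢0 b (f / n)}}
    power-split : ∀ x d → x ^ d ≡ x ^ (d % n) * (x ^ (d / n)) ^ n
    power-split x d = begin
      x ^ d                            ≡⟨ cong (x ^_) (m≡m%n+[m/n]*n d n) ⟩
      x ^ (d % n + d / n * n)          ≡⟨ ^-distribˡ-+-* x (d % n) (d / n * n) ⟩
      x ^ (d % n) * x ^ (d / n * n)    ≡⟨ cong (x ^ (d % n) *_) (^-*-assoc x (d / n) n) ⟨
      x ^ (d % n) * (x ^ (d / n)) ^ n  ∎
    split : a ^ e * b ^ f ≡ a ^ (e % n) * b ^ (f % n) * Q ^ n
    split = begin
      a ^ e * b ^ f  ≡⟨ cong₂ _*_ (power-split a e) (power-split b f) ⟩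
      a ^ (e % n) * (a ^ (e / n)) ^ n * (b ^ (f % n) * (b ^ (f / n)) ^ n)
                     ≡⟨ interchange (a ^ (e % n)) _ (b ^ (f % n)) _ ⟩
      a ^ (e % n) * b ^ (f % n) * ((a ^ (e / n)) ^ n * (b ^ (f / n)) ^ n)
                     ≡⟨ cong (a ^ (e % n) * b ^ (f % n) *_) (^-distribʳ-* (a ^ (e / n)) (b ^ (f / n)) n) ⟨
      a ^ (e % n) * b ^ (f % n) * Q ^ n  ∎

  data Consecutive : ℕ → ℕ → Set where
    ascending  : ∀ z .{{_ : NonZero z}} → Consecutive z (suc z)
    descending : ∀ z .{{_ : NonZero z}} → Consecutive (suc z) z

  consecutive-nonZero : ∀ {a b} → Consecutive a b → NonZero a × NonZero b
  consecutive-nonZero (ascending (suc z))  = _ , _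
  consecutive-nonZero (descending (suc z)) = _ , _

  NonSquareExponents : ℕ → ℕ → Set
  NonSquareExponents e f = e ≡ 1 × f ≡ 1

  consecutive-not-square : ∀ {a b e f} → Consecutive a b → NonSquareExponents e f → ¬ IsPower 2 (a ^ e * b ^ f)
  consecutive-not-square (ascending z) (refl , refl) =
    consecutive-product-not-square z ∘ subst (IsPower 2) (cong₂ _*_ (*-identityʳ z) (*-identityʳ (suc z)))
  consecutive-not-square (descending z) (refl , refl) =
    consecutive-product-not-square z ∘ subst (IsPower 2) (trans (cong₂ _*_ (*-identityʳ (suc z)) (*-identityʳ z)) (*-comm (suc z) z))

  NonCubeExponents : ℕ → ℕ → Set
  NonCubeExponents e f = (e ≡ 1 × f ≡ 1) ⊎ (e ≡ 1 × f ≡ 2) ⊎ (e ≡ 2 × f ≡ 1)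

  consecutive-not-cube : ∀ {a b e f} → Consecutive a b → NonCubeExponents e f → ¬ IsPower 3 (a ^ e * b ^ f)
  consecutive-not-cube (ascending z) (inj₁ (refl , refl)) =
    consecutive-product-not-cube z ∘ subst (IsPower 3) (cong₂ _*_ (*-identityʳ z) (*-identityʳ (suc z)))
  consecutive-not-cube (descending z) (inj₁ (refl , refl)) =
    consecutive-product-not-cube z ∘ subst (IsPower 3) (trans (cong₂ _*_ (*-identityʳ (suc z)) (*-identityʳ z)) (*-comm (suc z) z))
  consecutive-not-cube (ascending z) (inj₂ (inj₁ (refl , refl))) =
    not-cube-z[1+z]² z ∘ subst (IsPower 3) (cong (_* suc z ^ 2) (*-identityʳ z))
  consecutive-not-cube (descending z) (inj₂ (inj₁ (refl , refl))) =
    not-cube-z²[1+z] z ∘ subst (IsPower 3) (trans (cong (_* z ^ 2) (*-identityʳ (suc z))) (*-comm (suc z) (z ^ 2)))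
  consecutive-not-cube (ascending z) (inj₂ (inj₂ (refl , refl))) =
    not-cube-z²[1+z] z ∘ subst (IsPower 3) (cong (z ^ 2 *_) (*-identityʳ (suc z)))
  consecutive-not-cube (descending z) (inj₂ (inj₂ (refl , refl))) =
    not-cube-z[1+z]² z ∘ subst (IsPower 3) (trans (cong (suc z ^ 2 *_) (*-identityʳ z)) (*-comm (suc z ^ 2) z))

-- The closed form of h_n and its verification against the recursion of Defs.
module ExplicitFormula where

  open import Data.Nat as ℕ using (ℕ; zero; suc; _%_; _⊓_; _∸_)
  import Data.Nat.Properties as ℕP
  import Data.Nat.DivMod as ℕD
  open import Data.Nat.Divisibility using (divides)
  import Data.Nat.Tactic.RingSolver as ℕ-Solver
  open import Data.Integer using (ℤ; +_; -[1+_]; +[1+_]; _+_; _-_; _*_; -_; _^_; _/ℕ_)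
  import Data.Integer.Properties as ℤP
  open import Data.Integer.Tactic.RingSolver using (solve-∀; ring)
  open import Tactic.RingSolver.Core.AlmostCommutativeRing using (AlmostCommutativeRing)
  open AlmostCommutativeRing ring using () renaming (_^_ to _^ʳ_)
  open import Algebra.Properties.CommutativeSemigroup ℤP.*-commutativeSemigroup
    using (interchange) renaming (xy∙z≈xz∙y to *-swapʳ)
  open import Algebra.Properties.CommutativeSemigroup ℕP.+-commutativeSemigroup
    using () renaming (xy∙z≈xz∙y to +-swapʳ)
  open import Data.Product using (Σ-syntax; _×_; _,_; proj₁; proj₂)
  open import Data.Empty using (⊥-elim)
  open import Relation.Binary.PropositionalEquality
  open import Relation.Nullary using (¬_)
  open ≡-Reasoning

  [m+kd]/d≡m/d+k : ∀ m k d .{{_ : ℕ.NonZero d}} → (m ℕ.+ k ℕ.* d) ℕ./ d ≡ m ℕ./ d ℕ.+ k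
  [m+kd]/d≡m/d+k m k d = trans (ℕD.+-distrib-/-∣ʳ m (divides k refl)) (cong (m ℕ./ d ℕ.+_) (ℕD.m*n/n≡m k d))

  E F : ℕ → ℕ
  E n = 5 ℕ.* (n ℕ.* n) ℕ./ 12
  F n = n ℕ.* n ℕ./ 3

  -- The increment k·t·x + l·x² of a quadratic exponent when n = t moves to t + 12x.
  increment : ℕ → ℕ → ℕ → ℕ → ℕ
  increment k l t x = k ℕ.* t ℕ.* x ℕ.+ l ℕ.* (x ℕ.* x)

  E-shift : ∀ t x → E (t ℕ.+ x ℕ.* 12) ≡ E t ℕ.+ increment 10 60 t x
  E-shift t x = trans (cong (ℕ._/ 12) (square t x)) ([m+kd]/d≡m/d+k (5 ℕ.* (t ℕ.* t)) (increment 10 60 t x) 12)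
    where
    square : ∀ t x → 5 ℕ.* ((t ℕ.+ x ℕ.* 12) ℕ.* (t ℕ.+ x ℕ.* 12))
                   ≡ 5 ℕ.* (t ℕ.* t) ℕ.+ (10 ℕ.* t ℕ.* x ℕ.+ 60 ℕ.* (x ℕ.* x)) ℕ.* 12
    square = ℕ-Solver.solve-∀

  F-shift : ∀ t x → F (t ℕ.+ x ℕ.* 12) ≡ F t ℕ.+ increment 8 48 t x
  F-shift t x = trans (cong (ℕ._/ 3) (square t x)) ([m+kd]/d≡m/d+k (t ℕ.* t) (increment 8 48 t x) 3)
    where
    square : ∀ t x → (t ℕ.+ x ℕ.* 12) ℕ.* (t ℕ.+ x ℕ.* 12) ≡ t ℕ.* t ℕ.+ (8 ℕ.* t ℕ.* x ℕ.+ 48 ℕ.* (x ℕ.* x)) ℕ.* 3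
    square = ℕ-Solver.solve-∀

  sgn : ℕ → ℤ
  sgn 1  = + 1
  sgn 2  = -[1+ 0 ]
  sgn 3  = -[1+ 0 ]
  sgn 4  = + 1
  sgn 5  = + 1
  sgn 7  = -[1+ 0 ]
  sgn 8  = -[1+ 0 ]
  sgn 9  = + 1
  sgn 10 = + 1
  sgn 11 = -[1+ 0 ]
  sgn _  = + 0

  -- The increments satisfy the quadratic identities behind the doubling formulas;
  -- they hold for every increment k·t·x + l·x², whatever k and l.
  odd-increments : ∀ k l r j →
      increment k l (suc r ℕ.+ 2) j ℕ.+ 3 ℕ.* increment k l (suc r) j ≡ increment k l (suc (suc r ℕ.* 2)) (j ℕ.* 2)
    × increment k l r j ℕ.+ 3 ℕ.* increment k l (suc r ℕ.+ 1) j ≡ increment k l (suc (suc r ℕ.* 2)) (j ℕ.* 2)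
  odd-increments k l r j = first k l r j , second k l r j
    where
    first : ∀ k l r j → (k ℕ.* (suc r ℕ.+ 2) ℕ.* j ℕ.+ l ℕ.* (j ℕ.* j)) ℕ.+ 3 ℕ.* (k ℕ.* suc r ℕ.* j ℕ.+ l ℕ.* (j ℕ.* j))
                      ≡ k ℕ.* suc (suc r ℕ.* 2) ℕ.* (j ℕ.* 2) ℕ.+ l ℕ.* ((j ℕ.* 2) ℕ.* (j ℕ.* 2))
    first = ℕ-Solver.solve-∀
    second : ∀ k l r j → (k ℕ.* r ℕ.* j ℕ.+ l ℕ.* (j ℕ.* j)) ℕ.+ 3 ℕ.* (k ℕ.* (suc r ℕ.+ 1) ℕ.* j ℕ.+ l ℕ.* (j ℕ.* j))
                       ≡ k ℕ.* suc (suc r ℕ.* 2) ℕ.* (j ℕ.* 2) ℕ.+ l ℕ.* ((j ℕ.* 2) ℕ.* (j ℕ.* 2))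
    second = ℕ-Solver.solve-∀

  -- As odd-increments, for the two products in the even doubling formula.
  even-increments : ∀ k l r j →
      increment k l (suc (suc r)) j ℕ.+ (increment k l (suc (suc r) ℕ.+ 2) j ℕ.+ 2 ℕ.* increment k l (suc r) j)
        ≡ increment k l (suc (suc r) ℕ.* 2) (j ℕ.* 2)
    × increment k l (suc (suc r)) j ℕ.+ (increment k l r j ℕ.+ 2 ℕ.* increment k l (suc (suc r) ℕ.+ 1) j)
        ≡ increment k l (suc (suc r) ℕ.* 2) (j ℕ.* 2)
  even-increments k l r j = first k l r j , second k l r j
    where
    first : ∀ k l r j → (k ℕ.* suc (suc r) ℕ.* j ℕ.+ l ℕ.* (j ℕ.* j))
               ℕ.+ ((k ℕ.* (suc (suc r) ℕ.+ 2) ℕ.* j ℕ.+ l ℕ.* (j ℕ.* j)) ℕ.+ 2 ℕ.* (k ℕ.* suc r ℕ.* j ℕ.+ l ℕ.* (j ℕ.* j)))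
             ≡ k ℕ.* (suc (suc r) ℕ.* 2) ℕ.* (j ℕ.* 2) ℕ.+ l ℕ.* ((j ℕ.* 2) ℕ.* (j ℕ.* 2))
    first = ℕ-Solver.solve-∀
    second : ∀ k l r j → (k ℕ.* suc (suc r) ℕ.* j ℕ.+ l ℕ.* (j ℕ.* j))
               ℕ.+ ((k ℕ.* r ℕ.* j ℕ.+ l ℕ.* (j ℕ.* j)) ℕ.+ 2 ℕ.* (k ℕ.* (suc (suc r) ℕ.+ 1) ℕ.* j ℕ.+ l ℕ.* (j ℕ.* j)))
             ≡ k ℕ.* (suc (suc r) ℕ.* 2) ℕ.* (j ℕ.* 2) ℕ.+ l ℕ.* ((j ℕ.* 2) ℕ.* (j ℕ.* 2))
    second = ℕ-Solver.solve-∀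

  OddRec EvenRec : (ℕ → ℤ) → ℕ → ℤ
  OddRec c m = (c (m ℕ.+ 2) * (c m ^ 3)) - (c (m ℕ.∸ 1) * (c (m ℕ.+ 1) ^ 3))
  EvenRec c m = c m * ((c (m ℕ.+ 2) * (c (m ℕ.∸ 1) ^ 2)) - (c (m ℕ.∸ 2) * (c (m ℕ.+ 1) ^ 2)))

  ^-distribʳ-* : ∀ a b k → (a * b) ^ k ≡ a ^ k * b ^ k
  ^-distribʳ-* a b zero    = refl
  ^-distribʳ-* a b (suc k) = trans (cong (a * b *_) (^-distribʳ-* a b k)) (interchange a b (a ^ k) (b ^ k))

  separate : ∀ a p b q k → a * p * (b * q) ^ k ≡ a * b ^ k * (p * q ^ k)
  separate a p b q k = trans (cong (a * p *_) (^-distribʳ-* b q k)) (interchange a p (b ^ k) (q ^ k))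

  separate-difference : ∀ a p x q y u → a * p * (x * q - y * u) ≡ a * x * (p * q) - a * y * (p * u)
  separate-difference = solve-∀

  factorʳ : ∀ x y g → x * g - y * g ≡ (x - y) * g
  factorʳ = solve-∀

  factor-middle : ∀ a x y g → a * x * g - a * y * g ≡ a * (x - y) * g
  factor-middle = solve-∀

  ^≡^ʳ : ∀ x n → x ^ n ≡ x ^ʳ n
  ^≡^ʳ x zero          = refl
  ^≡^ʳ x (suc zero)    = ℤP.*-identityʳ x
  ^≡^ʳ x (suc (suc n)) = trans (cong (x *_) (^≡^ʳ x (suc n))) (ℤP.*-comm x _)

  divBy-exact : ∀ y {d} → Σ[ k ∈ ℕ ] d ≡ -[1+ k ] → divBy (y * d) d ≡ y
  divBy-exact (+ zero) (k , refl) = refl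
  divBy-exact +[1+ a ] (k , refl) = begin
    -[1+ 0 ] * (-[1+ k ℕ.+ a ℕ.* suc k ] /ℕ suc k)
      ≡⟨ cong (-[1+ 0 ] *_) (exact-negative (k ℕ.+ a ℕ.* suc k) (suc k) (ℕD.m*n%n≡0 (suc a) (suc k))) ⟩
    -[1+ 0 ] * - + (suc a ℕ.* suc k ℕ./ suc k)     ≡⟨ cong (λ q → -[1+ 0 ] * - + q) (ℕD.m*n/n≡m (suc a) (suc k)) ⟩
    -[1+ 0 ] * - +[1+ a ]                          ≡⟨ ℤP.-1*i≡-i (- +[1+ a ]) ⟩
    - - +[1+ a ]                                   ≡⟨ ℤP.neg-involutive +[1+ a ] ⟩
    +[1+ a ]                                       ∎
    where
    exact-negative : ∀ n d .{{_ : ℕ.NonZero d}} → suc n % d ≡ 0 → -[1+ n ] /ℕ d ≡ - + (suc n ℕ./ d)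
    exact-negative n d eq with suc n % d | eq
    ... | .0 | refl = refl
  divBy-exact -[1+ a ] (k , refl) =
    trans (cong (λ q → -[1+ 0 ] * + q) (ℕD.m*n/n≡m (suc a) (suc k))) (ℤP.-1*i≡-i +[1+ a ])

  h₂-negative : ∀ α → α ≢ -[1+ 0 ] → α ≢ + 0 → Σ[ k ∈ ℕ ] h₂ α ≡ -[1+ k ]
  h₂-negative (+ zero)      _     α≢0 = ⊥-elim (α≢0 refl)
  h₂-negative +[1+ a ]      _     _   = _ , refl
  h₂-negative -[1+ zero ]   α≢-1  _   = ⊥-elim (α≢-1 refl)
  h₂-negative -[1+ suc b ]  _     _   = _ , refl

  OddRec-cong : ∀ {c d : ℕ → ℤ} {f} m → (∀ i → i ℕ.< f → c i ≡ d i) → m ℕ.+ 2 ℕ.< f → OddRec c m ≡ OddRec d m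
  OddRec-cong {c} {d} m agree bound =
    cong₂ _-_ (cong₂ (λ a b → a * b ^ 3) (at (m ℕ.+ 2) ℕP.≤-refl) (at m (ℕP.m≤m+n m 2)))
              (cong₂ (λ a b → a * b ^ 3) (at (m ∸ 1) (ℕP.≤-trans (ℕP.m∸n≤m m 1) (ℕP.m≤m+n m 2)))
                                         (at (m ℕ.+ 1) (ℕP.+-monoʳ-≤ m (ℕP.n≤1+n 1))))
    where
    at : ∀ i → i ℕ.≤ m ℕ.+ 2 → c i ≡ d i
    at i i≤ = agree i (ℕP.≤-<-trans i≤ bound)

  EvenRec-cong : ∀ {c d : ℕ → ℤ} {f} m → (∀ i → i ℕ.< f → c i ≡ d i) → m ℕ.+ 2 ℕ.< f → EvenRec c m ≡ EvenRec d m
  EvenRec-cong {c} {d} m agree bound =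
    cong₂ _*_ (at m (ℕP.m≤m+n m 2))
      (cong₂ _-_ (cong₂ (λ a b → a * b ^ 2) (at (m ℕ.+ 2) ℕP.≤-refl) (at (m ∸ 1) (ℕP.≤-trans (ℕP.m∸n≤m m 1) (ℕP.m≤m+n m 2))))
                 (cong₂ (λ a b → a * b ^ 2) (at (m ∸ 2) (ℕP.≤-trans (ℕP.m∸n≤m m 2) (ℕP.m≤m+n m 2)))
                                            (at (m ℕ.+ 1) (ℕP.+-monoʳ-≤ m (ℕP.n≤1+n 1)))))
    where
    at : ∀ i → i ℕ.≤ m ℕ.+ 2 → c i ≡ d i
    at i i≤ = agree i (ℕP.≤-<-trans i≤ bound)

  -- For m = 2m′ + 6 resp. 2m′ + 5 (the even resp. odd branch of Defs with m ≥ 3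
  -- resp. m ≥ 2), all indices used by the doubling formula are below n.
  even-index-bound : ∀ m′ → 3 ℕ.+ m′ ℕ.+ 2 ℕ.< (3 ℕ.+ m′) ℕ.* 2
  even-index-bound m′ = subst (suc (3 ℕ.+ m′ ℕ.+ 2) ℕ.≤_) (sym (shape m′)) (ℕP.m≤m+n _ m′)
    where
    shape : ∀ m′ → (3 ℕ.+ m′) ℕ.* 2 ≡ suc (3 ℕ.+ m′ ℕ.+ 2) ℕ.+ m′
    shape = ℕ-Solver.solve-∀

  odd-index-bound : ∀ m′ → 2 ℕ.+ m′ ℕ.+ 2 ℕ.< suc ((2 ℕ.+ m′) ℕ.* 2)
  odd-index-bound m′ = subst (suc (2 ℕ.+ m′ ℕ.+ 2) ℕ.≤_) (sym (shape m′)) (ℕP.m≤m+n _ m′)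
    where
    shape : ∀ m′ → suc ((2 ℕ.+ m′) ℕ.* 2) ≡ suc (2 ℕ.+ m′ ℕ.+ 2) ℕ.+ m′
    shape = ℕ-Solver.solve-∀

  -- The reduced identities of the doubling formulas at m ≡ r + 1 (odd) and
  -- m ≡ r + 2 (even) modulo 12; they depend only on r mod 6.  Apart from
  -- sign bookkeeping, the only algebra involved is (α + 1) − 1 = α.
  reduced-odd₀ : ∀ A → -[1+ 0 ] * (A ^ʳ 0 * (A + + 1) ^ʳ 0) - + 0 * (A ^ʳ 0 * (A + + 1) ^ʳ 0) ≡ -[1+ 0 ] * (A ^ʳ 0 * (A + + 1) ^ʳ 0)
  reduced-odd₀ = solve-∀
  reduced-odd₁ : ∀ A → -[1+ 0 ] * (A ^ʳ 0 * (A + + 1) ^ʳ 0) - -[1+ 0 ] * (A ^ʳ 0 * (A + + 1) ^ʳ 1) ≡ + 1 * (A ^ʳ 1 * (A + + 1) ^ʳ 0)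
  reduced-odd₁ = solve-∀
  reduced-odd₂ : ∀ A → -[1+ 0 ] * (A ^ʳ 0 * (A + + 1) ^ʳ 1) - -[1+ 0 ] * (A ^ʳ 0 * (A + + 1) ^ʳ 0) ≡ -[1+ 0 ] * (A ^ʳ 1 * (A + + 1) ^ʳ 0)
  reduced-odd₂ = solve-∀
  reduced-odd₃ : ∀ A → + 0 * (A ^ʳ 0 * (A + + 1) ^ʳ 0) - -[1+ 0 ] * (A ^ʳ 0 * (A + + 1) ^ʳ 0) ≡ + 1 * (A ^ʳ 0 * (A + + 1) ^ʳ 0)
  reduced-odd₃ = solve-∀
  reduced-odd₄ : ∀ A → -[1+ 0 ] * (A ^ʳ 0 * (A + + 1) ^ʳ 0) - + 0 * (A ^ʳ 1 * (A + + 1) ^ʳ 1) ≡ -[1+ 0 ] * (A ^ʳ 0 * (A + + 1) ^ʳ 0)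
  reduced-odd₄ = solve-∀
  reduced-odd₅ : ∀ A → + 0 * (A ^ʳ 1 * (A + + 1) ^ʳ 1) - -[1+ 0 ] * (A ^ʳ 0 * (A + + 1) ^ʳ 0) ≡ + 1 * (A ^ʳ 0 * (A + + 1) ^ʳ 0)
  reduced-odd₅ = solve-∀
  reduced-even₀ : ∀ A → -[1+ 0 ] * (A ^ʳ 0 * (A + + 1) ^ʳ 0) - + 0 * (A ^ʳ 0 * (A + + 1) ^ʳ 1) ≡ -[1+ 0 ] * (A ^ʳ 0 * (A + + 1) ^ʳ 0)
  reduced-even₀ = solve-∀
  reduced-even₁ : ∀ A → -[1+ 0 ] * (A ^ʳ 0 * (A + + 1) ^ʳ 0) - -[1+ 0 ] * (A ^ʳ 0 * (A + + 1) ^ʳ 0) ≡ + 0 * (A ^ʳ 1 * (A + + 1) ^ʳ 0)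
  reduced-even₁ = solve-∀
  reduced-even₂ : ∀ A → + 0 * (A ^ʳ 0 * (A + + 1) ^ʳ 1) - -[1+ 0 ] * (A ^ʳ 0 * (A + + 1) ^ʳ 0) ≡ + 1 * (A ^ʳ 0 * (A + + 1) ^ʳ 0)
  reduced-even₂ = solve-∀
  reduced-even₃ : ∀ A → -[1+ 0 ] * (A ^ʳ 0 * (A + + 1) ^ʳ 0) - + 0 * (A ^ʳ 1 * (A + + 1) ^ʳ 1) ≡ -[1+ 0 ] * (A ^ʳ 0 * (A + + 1) ^ʳ 0)
  reduced-even₃ = solve-∀
  reduced-even₄ : ∀ A → + 0 * (A ^ʳ 0 * (A + + 1) ^ʳ 0) - + 0 * (A ^ʳ 0 * (A + + 1) ^ʳ 0) ≡ + 0 * (A ^ʳ 0 * (A + + 1) ^ʳ 0)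
  reduced-even₄ = solve-∀
  reduced-even₅ : ∀ A → + 0 * (A ^ʳ 1 * (A + + 1) ^ʳ 1) - -[1+ 0 ] * (A ^ʳ 0 * (A + + 1) ^ʳ 0) ≡ + 1 * (A ^ʳ 0 * (A + + 1) ^ʳ 0)
  reduced-even₅ = solve-∀

  module ClosedForm (α : ℤ) where

    B : ℤ
    B = α + + 1

    mono : ℕ → ℕ → ℤ
    mono e f = α ^ e * B ^ f

    closed : ℕ → ℤ
    closed n = sgn (n % 12) * mono (E n) (F n)

    mono-* : ∀ e f e′ f′ → mono e f * mono e′ f′ ≡ mono (e ℕ.+ e′) (f ℕ.+ f′)
    mono-* e f e′ f′ = begin
      α ^ e * B ^ f * (α ^ e′ * B ^ f′)   ≡⟨ interchange (α ^ e) (B ^ f) (α ^ e′) (B ^ f′) ⟩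
      α ^ e * α ^ e′ * (B ^ f * B ^ f′)   ≡⟨ cong₂ _*_ (ℤP.^-distribˡ-+-* α e e′) (ℤP.^-distribˡ-+-* B f f′) ⟨
      mono (e ℕ.+ e′) (f ℕ.+ f′)           ∎

    mono-^ : ∀ e f k → mono e f ^ k ≡ mono (k ℕ.* e) (k ℕ.* f)
    mono-^ e f zero    = refl
    mono-^ e f (suc k) = trans (cong (mono e f *_) (mono-^ e f k)) (mono-* e f (k ℕ.* e) (k ℕ.* f))

    mono-cube-product : ∀ e f e′ f′ → mono e f * mono e′ f′ ^ 3 ≡ mono (e ℕ.+ 3 ℕ.* e′) (f ℕ.+ 3 ℕ.* f′)
    mono-cube-product e f e′ f′ = trans (cong (mono e f *_) (mono-^ e′ f′ 3)) (mono-* e f _ _)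

    mono-square-product : ∀ e f e₁ f₁ e₂ f₂ →
      mono e f * (mono e₁ f₁ * mono e₂ f₂ ^ 2) ≡ mono (e ℕ.+ (e₁ ℕ.+ 2 ℕ.* e₂)) (f ℕ.+ (f₁ ℕ.+ 2 ℕ.* f₂))
    mono-square-product e f e₁ f₁ e₂ f₂ =
      trans (cong (mono e f *_) (trans (cong (mono e₁ f₁ *_) (mono-^ e₂ f₂ 2)) (mono-* e₁ f₁ _ _))) (mono-* e f _ _)

    -- The monomial by which closed (t + 12x) exceeds closed t.
    step : ℕ → ℕ → ℤ
    step t x = mono (increment 10 60 t x) (increment 8 48 t x)

    closed-shift : ∀ t x → closed (t ℕ.+ x ℕ.* 12) ≡ closed t * step t x
    closed-shift t x = begin
      sgn ((t ℕ.+ x ℕ.* 12) % 12) * mono (E (t ℕ.+ x ℕ.* 12)) (F (t ℕ.+ x ℕ.* 12))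
        ≡⟨ cong₂ (λ s m → sgn s * m) (ℕD.[m+kn]%n≡m%n t x 12) (cong₂ mono (E-shift t x) (F-shift t x)) ⟩
      sgn (t % 12) * mono (E t ℕ.+ increment 10 60 t x) (F t ℕ.+ increment 8 48 t x)
        ≡⟨ cong (sgn (t % 12) *_) (mono-* (E t) (F t) _ _) ⟨
      sgn (t % 12) * (mono (E t) (F t) * mono (increment 10 60 t x) (increment 8 48 t x))
          ≡⟨ ℤP.*-assoc (sgn (t % 12)) _ _ ⟨
      closed t * step t x
        ∎

    odd-periodic : ∀ r j → OddRec closed (suc r) ≡ closed (suc (suc r ℕ.* 2)) →
      OddRec closed (suc r ℕ.+ j ℕ.* 12) ≡ closed (suc ((suc r ℕ.+ j ℕ.* 12) ℕ.* 2))
    odd-periodic r j base = begin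
      OddRec closed (m ℕ.+ Δ)
        ≡⟨ cong₂ (λ a b → closed a * closed (m ℕ.+ Δ) ^ 3 - closed (r ℕ.+ Δ) * closed b ^ 3)
                 (+-swapʳ m Δ 2) (+-swapʳ m Δ 1) ⟩
      closed (m ℕ.+ 2 ℕ.+ Δ) * closed (m ℕ.+ Δ) ^ 3 - closed (r ℕ.+ Δ) * closed (m ℕ.+ 1 ℕ.+ Δ) ^ 3
        ≡⟨ cong₂ _-_ (cong₂ (λ a b → a * b ^ 3) (closed-shift (m ℕ.+ 2) j) (closed-shift m j))
                     (cong₂ (λ a b → a * b ^ 3) (closed-shift r j) (closed-shift (m ℕ.+ 1) j)) ⟩
      closed (m ℕ.+ 2) * step (m ℕ.+ 2) j * (closed m * step m j) ^ 3
        - closed r * step r j * (closed (m ℕ.+ 1) * step (m ℕ.+ 1) j) ^ 3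
        ≡⟨ cong₂ _-_ (separate (closed (m ℕ.+ 2)) (step (m ℕ.+ 2) j) (closed m) (step m j) 3)
                     (separate (closed r) (step r j) (closed (m ℕ.+ 1)) (step (m ℕ.+ 1) j) 3) ⟩
      closed (m ℕ.+ 2) * closed m ^ 3 * (step (m ℕ.+ 2) j * step m j ^ 3)
        - closed r * closed (m ℕ.+ 1) ^ 3 * (step r j * step (m ℕ.+ 1) j ^ 3)
        ≡⟨ cong₂ (λ p q → closed (m ℕ.+ 2) * closed m ^ 3 * p - closed r * closed (m ℕ.+ 1) ^ 3 * q) first second ⟩
      closed (m ℕ.+ 2) * closed m ^ 3 * G - closed r * closed (m ℕ.+ 1) ^ 3 * G
        ≡⟨ factorʳ (closed (m ℕ.+ 2) * closed m ^ 3) (closed r * closed (m ℕ.+ 1) ^ 3) G ⟩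
      OddRec closed m * G
        ≡⟨ cong (_* G) base ⟩
      closed (suc (suc r ℕ.* 2)) * G
        ≡⟨ closed-shift (suc (suc r ℕ.* 2)) (j ℕ.* 2) ⟨
      closed (suc (suc r ℕ.* 2) ℕ.+ j ℕ.* 2 ℕ.* 12)
        ≡⟨ cong closed (doubled-index r j) ⟩
      closed (suc ((m ℕ.+ Δ) ℕ.* 2))
        ∎
      where
      m = suc r
      Δ = j ℕ.* 12
      G = step (suc (suc r ℕ.* 2)) (j ℕ.* 2)
      step-cube : ∀ t t′ → step t j * step t′ j ^ 3
        ≡ mono (increment 10 60 t j ℕ.+ 3 ℕ.* increment 10 60 t′ j) (increment 8 48 t j ℕ.+ 3 ℕ.* increment 8 48 t′ j)
      step-cube t t′ = mono-cube-product (increment 10 60 t j) (increment 8 48 t j)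
                                         (increment 10 60 t′ j) (increment 8 48 t′ j)
      first : step (m ℕ.+ 2) j * step m j ^ 3 ≡ G
      first = trans (step-cube (m ℕ.+ 2) m)
                    (cong₂ mono (proj₁ (odd-increments 10 60 r j)) (proj₁ (odd-increments 8 48 r j)))
      second : step r j * step (m ℕ.+ 1) j ^ 3 ≡ G
      second = trans (step-cube r (m ℕ.+ 1))
                     (cong₂ mono (proj₂ (odd-increments 10 60 r j)) (proj₂ (odd-increments 8 48 r j)))
      doubled-index : ∀ r j → suc (suc r ℕ.* 2) ℕ.+ j ℕ.* 2 ℕ.* 12 ≡ suc ((suc r ℕ.+ j ℕ.* 12) ℕ.* 2)
      doubled-index = ℕ-Solver.solve-∀

    even-periodic : ∀ r j H → EvenRec closed (suc (suc r)) ≡ closed (suc (suc r) ℕ.* 2) * H →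
      EvenRec closed (suc (suc r) ℕ.+ j ℕ.* 12) ≡ closed ((suc (suc r) ℕ.+ j ℕ.* 12) ℕ.* 2) * H
    even-periodic r j H base = begin
      EvenRec closed (m ℕ.+ Δ)
        ≡⟨ cong₂ (λ a b → closed (m ℕ.+ Δ) * (closed a * closed (suc r ℕ.+ Δ) ^ 2 - closed (r ℕ.+ Δ) * closed b ^ 2))
                 (+-swapʳ m Δ 2) (+-swapʳ m Δ 1) ⟩
      closed (m ℕ.+ Δ) * (closed (m ℕ.+ 2 ℕ.+ Δ) * closed (suc r ℕ.+ Δ) ^ 2 - closed (r ℕ.+ Δ) * closed (m ℕ.+ 1 ℕ.+ Δ) ^ 2)
        ≡⟨ cong₂ _*_ (closed-shift m j)
             (cong₂ _-_ (cong₂ (λ a b → a * b ^ 2) (closed-shift (m ℕ.+ 2) j) (closed-shift (suc r) j))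
                        (cong₂ (λ a b → a * b ^ 2) (closed-shift r j) (closed-shift (m ℕ.+ 1) j))) ⟩
      closed m * step m j * (closed (m ℕ.+ 2) * step (m ℕ.+ 2) j * (closed (suc r) * step (suc r) j) ^ 2
                            - closed r * step r j * (closed (m ℕ.+ 1) * step (m ℕ.+ 1) j) ^ 2)
        ≡⟨ cong (closed m * step m j *_)
             (cong₂ _-_ (separate (closed (m ℕ.+ 2)) (step (m ℕ.+ 2) j) (closed (suc r)) (step (suc r) j) 2)
                        (separate (closed r) (step r j) (closed (m ℕ.+ 1)) (step (m ℕ.+ 1) j) 2)) ⟩
      closed m * step m j * (X * (step (m ℕ.+ 2) j * step (suc r) j ^ 2) - Y * (step r j * step (m ℕ.+ 1) j ^ 2))
        ≡⟨ separate-difference (closed m) (step m j) X _ Y _ ⟩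
      closed m * X * (step m j * (step (m ℕ.+ 2) j * step (suc r) j ^ 2))
        - closed m * Y * (step m j * (step r j * step (m ℕ.+ 1) j ^ 2))
        ≡⟨ cong₂ (λ p q → closed m * X * p - closed m * Y * q) first second ⟩
      closed m * X * G - closed m * Y * G
        ≡⟨ factor-middle (closed m) X Y G ⟩
      EvenRec closed m * G
        ≡⟨ cong (_* G) base ⟩
      closed (m ℕ.* 2) * H * G
        ≡⟨ *-swapʳ (closed (m ℕ.* 2)) H G ⟩
      closed (m ℕ.* 2) * G * H
        ≡⟨ cong (_* H) (closed-shift (m ℕ.* 2) (j ℕ.* 2)) ⟨
      closed (m ℕ.* 2 ℕ.+ j ℕ.* 2 ℕ.* 12) * H
        ≡⟨ cong (λ n → closed n * H) (doubled-index r j) ⟩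
      closed ((m ℕ.+ Δ) ℕ.* 2) * H
        ∎
      where
      m = suc (suc r)
      Δ = j ℕ.* 12
      X = closed (m ℕ.+ 2) * closed (suc r) ^ 2
      Y = closed r * closed (m ℕ.+ 1) ^ 2
      G = step (m ℕ.* 2) (j ℕ.* 2)
      step-square : ∀ t t₁ t₂ → step t j * (step t₁ j * step t₂ j ^ 2)
        ≡ mono (increment 10 60 t j ℕ.+ (increment 10 60 t₁ j ℕ.+ 2 ℕ.* increment 10 60 t₂ j))
               (increment 8 48 t j ℕ.+ (increment 8 48 t₁ j ℕ.+ 2 ℕ.* increment 8 48 t₂ j))
      step-square t t₁ t₂ = mono-square-product (increment 10 60 t j) (increment 8 48 t j)
        (increment 10 60 t₁ j) (increment 8 48 t₁ j) (increment 10 60 t₂ j) (increment 8 48 t₂ j)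
      first : step m j * (step (m ℕ.+ 2) j * step (suc r) j ^ 2) ≡ G
      first = trans (step-square m (m ℕ.+ 2) (suc r))
                    (cong₂ mono (proj₁ (even-increments 10 60 r j)) (proj₁ (even-increments 8 48 r j)))
      second : step m j * (step r j * step (m ℕ.+ 1) j ^ 2) ≡ G
      second = trans (step-square m r (m ℕ.+ 1))
                     (cong₂ mono (proj₂ (even-increments 10 60 r j)) (proj₂ (even-increments 8 48 r j)))
      doubled-index : ∀ r j → suc (suc r) ℕ.* 2 ℕ.+ j ℕ.* 2 ℕ.* 12 ≡ (suc (suc r) ℕ.+ j ℕ.* 12) ℕ.* 2
      doubled-index = ℕ-Solver.solve-∀

    -- The monomial α^u (α+1)^v written with the ring solver's power function,
    -- so that identities between such monomials are decided by solve-∀.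
    K : ℕ → ℕ → ℤ
    K u v = α ^ʳ u * B ^ʳ v

    mono-split : ∀ c d e f → c ℕ.≤ e → d ℕ.≤ f → mono e f ≡ mono c d * K (e ∸ c) (f ∸ d)
    mono-split c d e f c≤e d≤f = begin
      mono e f                          ≡⟨ cong₂ mono (ℕP.m+[n∸m]≡n c≤e) (ℕP.m+[n∸m]≡n d≤f) ⟨
      mono (c ℕ.+ (e ∸ c)) (d ℕ.+ (f ∸ d)) ≡⟨ mono-* c d (e ∸ c) (f ∸ d) ⟨
      mono c d * mono (e ∸ c) (f ∸ d)   ≡⟨ cong (mono c d *_) (cong₂ _*_ (^≡^ʳ α (e ∸ c)) (^≡^ʳ B (f ∸ d))) ⟩
      mono c d * K (e ∸ c) (f ∸ d)      ∎

    -- The identity s₁·M₁ − s₂·M₂ = s·M between signed monomials M = α^e (α+1)^f,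
    -- divided by the greatest common divisor α^c (α+1)^d of M₁, M₂ and M.
    Reduced : ℤ → ℕ → ℕ → ℤ → ℕ → ℕ → ℤ → ℕ → ℕ → Set
    Reduced s₁ e₁ f₁ s₂ e₂ f₂ s e f =
      let c = e₁ ⊓ e₂ ⊓ e ; d = f₁ ⊓ f₂ ⊓ f in
      s₁ * K (e₁ ∸ c) (f₁ ∸ d) - s₂ * K (e₂ ∸ c) (f₂ ∸ d) ≡ s * K (e ∸ c) (f ∸ d)

    factor-common : ∀ s₁ e₁ f₁ s₂ e₂ f₂ s e f → Reduced s₁ e₁ f₁ s₂ e₂ f₂ s e f →
      s₁ * mono e₁ f₁ - s₂ * mono e₂ f₂ ≡ s * mono e f
    factor-common s₁ e₁ f₁ s₂ e₂ f₂ s e f reduced = begin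
      s₁ * mono e₁ f₁ - s₂ * mono e₂ f₂
        ≡⟨ cong₂ (λ x y → s₁ * x - s₂ * y) (mono-split c d e₁ f₁ (ℕP.≤-trans (ℕP.m⊓n≤m _ e) (ℕP.m⊓n≤m e₁ e₂))
                                                             (ℕP.≤-trans (ℕP.m⊓n≤m _ f) (ℕP.m⊓n≤m f₁ f₂)))
                                          (mono-split c d e₂ f₂ (ℕP.≤-trans (ℕP.m⊓n≤m _ e) (ℕP.m⊓n≤n e₁ e₂))
                                                             (ℕP.≤-trans (ℕP.m⊓n≤m _ f) (ℕP.m⊓n≤n f₁ f₂))) ⟩
      s₁ * (M * K₁) - s₂ * (M * K₂)  ≡⟨ pull-out s₁ s₂ M K₁ K₂ ⟩
      (s₁ * K₁ - s₂ * K₂) * M        ≡⟨ cong (_* M) reduced ⟩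
      s * K (e ∸ c) (f ∸ d) * M      ≡⟨ push-in s (K (e ∸ c) (f ∸ d)) M ⟩
      s * (M * K (e ∸ c) (f ∸ d))    ≡⟨ cong (s *_) (mono-split c d e f (ℕP.m⊓n≤n _ e) (ℕP.m⊓n≤n _ f)) ⟨
      s * mono e f                   ∎
      where
      c = e₁ ⊓ e₂ ⊓ e
      d = f₁ ⊓ f₂ ⊓ f
      M = mono c d
      K₁ = K (e₁ ∸ c) (f₁ ∸ d)
      K₂ = K (e₂ ∸ c) (f₂ ∸ d)
      pull-out : ∀ s₁ s₂ M K₁ K₂ → s₁ * (M * K₁) - s₂ * (M * K₂) ≡ (s₁ * K₁ - s₂ * K₂) * M
      pull-out = solve-∀
      push-in : ∀ s k M → s * k * M ≡ s * (M * k)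
      push-in = solve-∀

    closed-cube-product : ∀ a b → closed a * closed b ^ 3
      ≡ (sgn (a % 12) * sgn (b % 12) ^ 3) * mono (E a ℕ.+ 3 ℕ.* E b) (F a ℕ.+ 3 ℕ.* F b)
    closed-cube-product a b =
      trans (separate (sgn (a % 12)) (mono (E a) (F a)) (sgn (b % 12)) (mono (E b) (F b)) 3)
            (cong (sgn (a % 12) * sgn (b % 12) ^ 3 *_) (mono-cube-product (E a) (F a) (E b) (F b)))

    closed-square-product : ∀ a b c → closed a * (closed b * closed c ^ 2)
      ≡ (sgn (a % 12) * (sgn (b % 12) * sgn (c % 12) ^ 2))
        * mono (E a ℕ.+ (E b ℕ.+ 2 ℕ.* E c)) (F a ℕ.+ (F b ℕ.+ 2 ℕ.* F c))
    closed-square-product a b c = begin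
      sa * Ma * (closed b * closed c ^ 2)
        ≡⟨ cong (sa * Ma *_) (separate (sgn (b % 12)) (mono (E b) (F b)) (sgn (c % 12)) (mono (E c) (F c)) 2) ⟩
      sa * Ma * (sgn (b % 12) * sgn (c % 12) ^ 2 * (mono (E b) (F b) * mono (E c) (F c) ^ 2))
        ≡⟨ interchange sa Ma _ _ ⟩
      sa * (sgn (b % 12) * sgn (c % 12) ^ 2) * (Ma * (mono (E b) (F b) * mono (E c) (F c) ^ 2))
        ≡⟨ cong (sa * (sgn (b % 12) * sgn (c % 12) ^ 2) *_) (mono-square-product (E a) (F a) (E b) (F b) (E c) (F c)) ⟩
      sa * (sgn (b % 12) * sgn (c % 12) ^ 2) * mono (E a ℕ.+ (E b ℕ.+ 2 ℕ.* E c)) (F a ℕ.+ (F b ℕ.+ 2 ℕ.* F c))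
        ∎
      where
      sa = sgn (a % 12)
      Ma = mono (E a) (F a)

    times-h₂ : ∀ s e f → s * mono e f * h₂ α ≡ (- s) * mono (e ℕ.+ 1) (f ℕ.+ 1)
    times-h₂ s e f = begin
      s * mono e f * - (α * B)        ≡⟨ move-sign s (mono e f) (α * B) ⟩
      (- s) * (mono e f * (α * B))    ≡⟨ cong (λ x → (- s) * (mono e f * x)) (cong₂ _*_ (ℤP.*-identityʳ α) (ℤP.*-identityʳ B)) ⟨
      (- s) * (mono e f * mono 1 1)   ≡⟨ cong ((- s) *_) (mono-* e f 1 1) ⟩
      (- s) * mono (e ℕ.+ 1) (f ℕ.+ 1) ∎
      where
      move-sign : ∀ s m x → s * m * - x ≡ (- s) * (m * x)
      move-sign = solve-∀

    odd-base : ∀ r → let m = suc r ; n = suc (suc r ℕ.* 2) in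
      Reduced (sgn ((m ℕ.+ 2) % 12) * sgn (m % 12) ^ 3) (E (m ℕ.+ 2) ℕ.+ 3 ℕ.* E m) (F (m ℕ.+ 2) ℕ.+ 3 ℕ.* F m)
              (sgn (r % 12) * sgn ((m ℕ.+ 1) % 12) ^ 3) (E r ℕ.+ 3 ℕ.* E (m ℕ.+ 1)) (F r ℕ.+ 3 ℕ.* F (m ℕ.+ 1))
              (sgn (n % 12)) (E n) (F n) →
      OddRec closed m ≡ closed n
    odd-base r reduced =
      trans (cong₂ _-_ (closed-cube-product (suc r ℕ.+ 2) (suc r)) (closed-cube-product r (suc r ℕ.+ 1)))
            (factor-common s₁ e₁ f₁ s₂ e₂ f₂ (sgn (n % 12)) (E n) (F n) reduced)
      where
      m = suc r
      n = suc (suc r ℕ.* 2)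
      s₁ = sgn ((m ℕ.+ 2) % 12) * sgn (m % 12) ^ 3
      e₁ = E (m ℕ.+ 2) ℕ.+ 3 ℕ.* E m
      f₁ = F (m ℕ.+ 2) ℕ.+ 3 ℕ.* F m
      s₂ = sgn (r % 12) * sgn ((m ℕ.+ 1) % 12) ^ 3
      e₂ = E r ℕ.+ 3 ℕ.* E (m ℕ.+ 1)
      f₂ = F r ℕ.+ 3 ℕ.* F (m ℕ.+ 1)

    even-base : ∀ r → let m = suc (suc r) ; n = suc (suc r) ℕ.* 2 in
      Reduced (sgn (m % 12) * (sgn ((m ℕ.+ 2) % 12) * sgn (suc r % 12) ^ 2))
                (E m ℕ.+ (E (m ℕ.+ 2) ℕ.+ 2 ℕ.* E (suc r))) (F m ℕ.+ (F (m ℕ.+ 2) ℕ.+ 2 ℕ.* F (suc r)))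
              (sgn (m % 12) * (sgn (r % 12) * sgn ((m ℕ.+ 1) % 12) ^ 2))
                (E m ℕ.+ (E r ℕ.+ 2 ℕ.* E (m ℕ.+ 1))) (F m ℕ.+ (F r ℕ.+ 2 ℕ.* F (m ℕ.+ 1)))
              (- sgn (n % 12)) (E n ℕ.+ 1) (F n ℕ.+ 1) →
      EvenRec closed m ≡ closed n * h₂ α
    even-base r reduced =
      trans (distribute (closed m) (closed (m ℕ.+ 2) * closed (suc r) ^ 2) (closed r * closed (m ℕ.+ 1) ^ 2))
      (trans (cong₂ _-_ (closed-square-product m (m ℕ.+ 2) (suc r)) (closed-square-product m r (m ℕ.+ 1)))
      (trans (factor-common s₁ e₁ f₁ s₂ e₂ f₂ (- sgn (n % 12)) (E n ℕ.+ 1) (F n ℕ.+ 1) reduced)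
             (sym (times-h₂ (sgn (n % 12)) (E n) (F n)))))
      where
      m = suc (suc r)
      n = m ℕ.* 2
      s₁ = sgn (m % 12) * (sgn ((m ℕ.+ 2) % 12) * sgn (suc r % 12) ^ 2)
      e₁ = E m ℕ.+ (E (m ℕ.+ 2) ℕ.+ 2 ℕ.* E (suc r))
      f₁ = F m ℕ.+ (F (m ℕ.+ 2) ℕ.+ 2 ℕ.* F (suc r))
      s₂ = sgn (m % 12) * (sgn (r % 12) * sgn ((m ℕ.+ 1) % 12) ^ 2)
      e₂ = E m ℕ.+ (E r ℕ.+ 2 ℕ.* E (m ℕ.+ 1))
      f₂ = F m ℕ.+ (F r ℕ.+ 2 ℕ.* F (m ℕ.+ 1))
      distribute : ∀ a x y → a * (x - y) ≡ a * x - a * y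
      distribute = solve-∀

    odd-formula-base : ∀ t → t ℕ.< 12 → OddRec closed (suc t) ≡ closed (suc (suc t ℕ.* 2))
    odd-formula-base 0 _ = odd-base 0 (reduced-odd₀ α)
    odd-formula-base 1 _ = odd-base 1 (reduced-odd₁ α)
    odd-formula-base 2 _ = odd-base 2 (reduced-odd₂ α)
    odd-formula-base 3 _ = odd-base 3 (reduced-odd₃ α)
    odd-formula-base 4 _ = odd-base 4 (reduced-odd₄ α)
    odd-formula-base 5 _ = odd-base 5 (reduced-odd₅ α)
    odd-formula-base 6 _ = odd-base 6 (reduced-odd₀ α)
    odd-formula-base 7 _ = odd-base 7 (reduced-odd₁ α)
    odd-formula-base 8 _ = odd-base 8 (reduced-odd₂ α)
    odd-formula-base 9 _ = odd-base 9 (reduced-odd₃ α)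
    odd-formula-base 10 _ = odd-base 10 (reduced-odd₄ α)
    odd-formula-base 11 _ = odd-base 11 (reduced-odd₅ α)
    odd-formula-base (suc (suc (suc (suc (suc (suc (suc (suc (suc (suc (suc (suc t)))))))))))) t<12 =
      ⊥-elim (ℕP.m+n≮m 12 t t<12)

    even-formula-base : ∀ t → t ℕ.< 12 → EvenRec closed (suc (suc t)) ≡ closed (suc (suc t) ℕ.* 2) * h₂ α
    even-formula-base 0 _ = even-base 0 (reduced-even₀ α)
    even-formula-base 1 _ = even-base 1 (reduced-even₁ α)
    even-formula-base 2 _ = even-base 2 (reduced-even₂ α)
    even-formula-base 3 _ = even-base 3 (reduced-even₃ α)
    even-formula-base 4 _ = even-base 4 (reduced-even₄ α)
    even-formula-base 5 _ = even-base 5 (reduced-even₅ α)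
    even-formula-base 6 _ = even-base 6 (reduced-even₀ α)
    even-formula-base 7 _ = even-base 7 (reduced-even₁ α)
    even-formula-base 8 _ = even-base 8 (reduced-even₂ α)
    even-formula-base 9 _ = even-base 9 (reduced-even₃ α)
    even-formula-base 10 _ = even-base 10 (reduced-even₄ α)
    even-formula-base 11 _ = even-base 11 (reduced-even₅ α)
    even-formula-base (suc (suc (suc (suc (suc (suc (suc (suc (suc (suc (suc (suc t)))))))))))) t<12 =
      ⊥-elim (ℕP.m+n≮m 12 t t<12)

    odd-formula : ∀ r → OddRec closed (suc r) ≡ closed (suc (suc r ℕ.* 2))
    odd-formula r = subst (λ r → OddRec closed (suc r) ≡ closed (suc (suc r ℕ.* 2)))
                          (sym (ℕD.m≡m%n+[m/n]*n r 12))
                          (odd-periodic (r % 12) (r ℕ./ 12) (odd-formula-base (r % 12) (ℕD.m%n<n r 12)))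

    even-formula : ∀ r → EvenRec closed (suc (suc r)) ≡ closed (suc (suc r) ℕ.* 2) * h₂ α
    even-formula r = subst (λ r → EvenRec closed (suc (suc r)) ≡ closed (suc (suc r) ℕ.* 2) * h₂ α)
                           (sym (ℕD.m≡m%n+[m/n]*n r 12))
                           (even-periodic (r % 12) (r ℕ./ 12) (h₂ α) (even-formula-base (r % 12) (ℕD.m%n<n r 12)))

    module _ (α≢-1 : α ≢ -[1+ 0 ]) (α≢0 : α ≢ + 0) where

      even-quotient : ∀ r → divBy (EvenRec closed (suc (suc r))) (h₂ α) ≡ closed (suc (suc r) ℕ.* 2)
      even-quotient r = trans (cong (λ x → divBy x (h₂ α)) (even-formula r))
                              (divBy-exact (closed (suc (suc r) ℕ.* 2)) (h₂-negative α α≢-1 α≢0))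

      -- The fuel-bounded recursion of Defs computes the closed form: the initial
      -- values agree, and in the recursive branches the fuel covers every index read.
      hGo-closed : ∀ f n → n ℕ.< f → hGo α f n ≡ closed n
      hGo-closed (suc f) 0 _ = refl
      hGo-closed (suc f) 1 _ = refl
      hGo-closed (suc f) 2 _ = sym (trans (ℤP.-1*i≡-i _) (cong -_ (cong₂ _*_ (ℤP.*-identityʳ α) (ℤP.*-identityʳ B))))
      hGo-closed (suc f) 3 _ = sym (ℤP.-1*i≡-i _)
      hGo-closed (suc f) 4 _ = sym (ℤP.*-identityˡ _)
      hGo-closed (suc f) n@(suc (suc (suc (suc (suc k))))) n<f with n % 2 in parity
      ... | 0 = even-branch k (n ℕ./ 2) (trans (ℕD.m≡m%n+[m/n]*n n 2) (cong (ℕ._+ n ℕ./ 2 ℕ.* 2) parity)) (ℕP.≤-pred n<f)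
        where
        even-branch : ∀ k m → 5 ℕ.+ k ≡ m ℕ.* 2 → 5 ℕ.+ k ℕ.≤ f → divBy (EvenRec (hGo α f) m) (h₂ α) ≡ closed (5 ℕ.+ k)
        even-branch k (suc (suc (suc m′))) refl n≤f =
          trans (cong (λ x → divBy x (h₂ α)) (EvenRec-cong (3 ℕ.+ m′) (hGo-closed f) (ℕP.<-≤-trans (even-index-bound m′) n≤f)))
                (even-quotient (suc m′))
      ... | 1 = odd-branch k (n ℕ./ 2) (trans (ℕD.m≡m%n+[m/n]*n n 2) (cong (ℕ._+ n ℕ./ 2 ℕ.* 2) parity)) (ℕP.≤-pred n<f)
        where
        odd-branch : ∀ k m → 5 ℕ.+ k ≡ suc (m ℕ.* 2) → 5 ℕ.+ k ℕ.≤ f → OddRec (hGo α f) m ≡ closed (5 ℕ.+ k)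
        odd-branch k (suc (suc m′)) refl n≤f =
          trans (OddRec-cong (2 ℕ.+ m′) (hGo-closed f) (ℕP.<-≤-trans (odd-index-bound m′) n≤f))
                (odd-formula (suc m′))
      ... | suc (suc _) = ⊥-elim (ℕP.<⇒≱ (ℕD.m%n<n n 2) (subst (2 ℕ.≤_) (sym parity) (ℕ.s≤s (ℕ.s≤s ℕ.z≤n))))

      h≡closed : ∀ n → h α n ≡ closed n
      h≡closed n = hGo-closed (suc n) n ℕP.≤-refl

-- The reduced exponents of h_n for the residues of the theorem, and the link
-- between |h_n| and the perfect powers above.
module Obstructions where
  open PerfectPowers
  open ExplicitFormula
  open import Data.Nat as ℕ using (zero; suc; _+_; _*_; _^_; _<_)
  import Data.Nat.Properties as ℕP
  import Data.Nat.DivMod as ℕD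
  import Data.Nat.Tactic.RingSolver as ℕ-Solver
  open import Data.Integer as ℤ using (∣_∣; +[1+_])
  import Data.Integer.Properties as ℤP
  open import Data.Product using (_,_; proj₁; proj₂)
  open import Data.Sum using (inj₁; inj₂)
  open import Data.Empty using (⊥-elim)
  open import Function using (_∘_)
  open import Relation.Binary.PropositionalEquality

  E-mod-2 : ∀ t x → E (t + x * 12) % 2 ≡ E t % 2
  E-mod-2 t x = trans (cong (_% 2) (trans (E-shift t x) (cong (λ i → E t + i) (halve t x))))
                      (ℕD.[m+kn]%n≡m%n (E t) (5 * t * x + 30 * (x * x)) 2)
    where
    halve : ∀ t x → 10 * t * x + 60 * (x * x) ≡ (5 * t * x + 30 * (x * x)) * 2
    halve = ℕ-Solver.solve-∀

  F-mod-2 : ∀ t x → F (t + x * 12) % 2 ≡ F t % 2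
  F-mod-2 t x = trans (cong (_% 2) (trans (F-shift t x) (cong (λ i → F t + i) (halve t x))))
                      (ℕD.[m+kn]%n≡m%n (F t) (4 * t * x + 24 * (x * x)) 2)
    where
    halve : ∀ t x → 8 * t * x + 48 * (x * x) ≡ (4 * t * x + 24 * (x * x)) * 2
    halve = ℕ-Solver.solve-∀

  E-mod-3 : ∀ t y → E (t + y * 36) % 3 ≡ E t % 3
  E-mod-3 t y = trans (cong (λ n → E n % 3) (cong (λ k → t + k) (sym (ℕP.*-assoc y 3 12))))
                (trans (cong (_% 3) (trans (E-shift t (y * 3)) (cong (λ i → E t + i) (third t y))))
                       (ℕD.[m+kn]%n≡m%n (E t) (10 * t * y + 180 * (y * y)) 3))
    where
    third : ∀ t y → 10 * t * (y * 3) + 60 * ((y * 3) * (y * 3)) ≡ (10 * t * y + 180 * (y * y)) * 3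
    third = ℕ-Solver.solve-∀

  F-mod-3 : ∀ t y → F (t + y * 36) % 3 ≡ F t % 3
  F-mod-3 t y = trans (cong (λ n → F n % 3) (cong (λ k → t + k) (sym (ℕP.*-assoc y 3 12))))
                (trans (cong (_% 3) (trans (F-shift t (y * 3)) (cong (λ i → F t + i) (third t y))))
                       (ℕD.[m+kn]%n≡m%n (F t) (8 * t * y + 144 * (y * y)) 3))
    where
    third : ∀ t y → 8 * t * (y * 3) + 48 * ((y * 3) * (y * 3)) ≡ (8 * t * y + 144 * (y * y)) * 3
    third = ℕ-Solver.solve-∀

  square-table : ∀ t → (t ≡ 2 ⊎ t ≡ 3 ⊎ t ≡ 9 ⊎ t ≡ 10) →
    ∣ sgn t ∣ ≡ 1 × NonSquareExponents (E t % 2) (F t % 2)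
  square-table _ (inj₁ refl)                 = refl , refl , refl
  square-table _ (inj₂ (inj₁ refl))          = refl , refl , refl
  square-table _ (inj₂ (inj₂ (inj₁ refl)))   = refl , refl , refl
  square-table _ (inj₂ (inj₂ (inj₂ refl)))   = refl , refl , refl

  -- The residues t = r + 18b mod 36 of part (ii): the sign of h_t is ±1 and
  -- (E t, F t) mod 3 is one of (1,1), (1,2), (2,1).
  cube-table : ∀ r b → (r ≡ 2 ⊎ r ≡ 5 ⊎ r ≡ 7 ⊎ r ≡ 11 ⊎ r ≡ 13 ⊎ r ≡ 16) → b < 2 →
    ∣ sgn ((r + b * 18) % 12) ∣ ≡ 1 × NonCubeExponents (E (r + b * 18) % 3) (F (r + b * 18) % 3)
  cube-table _ 0 (inj₁ refl)                                 _ = refl , inj₁ (refl , refl)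
  cube-table _ 1 (inj₁ refl)                                 _ = refl , inj₁ (refl , refl)
  cube-table _ 0 (inj₂ (inj₁ refl))                          _ = refl , inj₂ (inj₁ (refl , refl))
  cube-table _ 1 (inj₂ (inj₁ refl))                          _ = refl , inj₂ (inj₁ (refl , refl))
  cube-table _ 0 (inj₂ (inj₂ (inj₁ refl)))                   _ = refl , inj₂ (inj₂ (refl , refl))
  cube-table _ 1 (inj₂ (inj₂ (inj₁ refl)))                   _ = refl , inj₂ (inj₂ (refl , refl))
  cube-table _ 0 (inj₂ (inj₂ (inj₂ (inj₁ refl))))            _ = refl , inj₂ (inj₂ (refl , refl))
  cube-table _ 1 (inj₂ (inj₂ (inj₂ (inj₁ refl))))            _ = refl , inj₂ (inj₂ (refl , refl))
  cube-table _ 0 (inj₂ (inj₂ (inj₂ (inj₂ (inj₁ refl)))))     _ = refl , inj₂ (inj₁ (refl , refl))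
  cube-table _ 1 (inj₂ (inj₂ (inj₂ (inj₂ (inj₁ refl)))))     _ = refl , inj₂ (inj₁ (refl , refl))
  cube-table _ 0 (inj₂ (inj₂ (inj₂ (inj₂ (inj₂ refl)))))     _ = refl , inj₁ (refl , refl)
  cube-table _ 1 (inj₂ (inj₂ (inj₂ (inj₂ (inj₂ refl)))))     _ = refl , inj₁ (refl , refl)
  cube-table _ (suc (suc _)) _ (ℕ.s≤s (ℕ.s≤s ()))

  square-exponents : ∀ n → (n % 12 ≡ 2 ⊎ n % 12 ≡ 3 ⊎ n % 12 ≡ 9 ⊎ n % 12 ≡ 10) →
    ∣ sgn (n % 12) ∣ ≡ 1 × NonSquareExponents (E n % 2) (F n % 2)
  square-exponents n residue =
    proj₁ table , trans (trans (cong (λ m → E m % 2) n≡t+12x) (E-mod-2 (n % 12) (n ℕ./ 12))) (proj₁ (proj₂ table))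
                , trans (trans (cong (λ m → F m % 2) n≡t+12x) (F-mod-2 (n % 12) (n ℕ./ 12))) (proj₂ (proj₂ table))
    where
    table = square-table (n % 12) residue
    n≡t+12x = ℕD.m≡m%n+[m/n]*n n 12

  -- Part (ii) on the level of exponents; n = t + 36y with t = (n mod 18) + 18·((n div 18) mod 2).
  cube-exponents : ∀ n → (n % 18 ≡ 2 ⊎ n % 18 ≡ 5 ⊎ n % 18 ≡ 7 ⊎ n % 18 ≡ 11 ⊎ n % 18 ≡ 13 ⊎ n % 18 ≡ 16) →
    ∣ sgn (n % 12) ∣ ≡ 1 × NonCubeExponents (E n % 3) (F n % 3)
  cube-exponents n residue =
    subst (λ s → ∣ sgn s ∣ ≡ 1) (sym sign-residue) (proj₁ table) ,
    subst₂ NonCubeExponents (sym (trans (cong (λ m → E m % 3) n≡t+36y) (E-mod-3 t y)))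
                            (sym (trans (cong (λ m → F m % 3) n≡t+36y) (F-mod-3 t y))) (proj₂ table)
    where
    q = n ℕ./ 18
    table = cube-table (n % 18) (q % 2) residue (ℕD.m%n<n q 2)
    y = q ℕ./ 2
    t = n % 18 + q % 2 * 18
    n≡t+36y : n ≡ t + y * 36
    n≡t+36y = trans (ℕD.m≡m%n+[m/n]*n n 18)
                    (trans (cong (λ p → n % 18 + p * 18) (ℕD.m≡m%n+[m/n]*n q 2)) (regroup (n % 18) (q % 2) y))
      where
      regroup : ∀ r b y → r + (b + y * 2) * 18 ≡ r + b * 18 + y * 36
      regroup = ℕ-Solver.solve-∀
    sign-residue : n % 12 ≡ t % 12
    sign-residue = trans (cong (_% 12) (trans n≡t+36y (cong (λ k → t + k) (sym (ℕP.*-assoc y 3 12)))))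
                         (ℕD.[m+kn]%n≡m%n t (y * 3) 12)

  square⇒power : ∀ {m} → IsSquare m → IsPower 2 ∣ m ∣
  square⇒power {m} (β , _ , m≡±β²) = ∣ β ∣ , trans (abs-±β² m≡±β²) (cong (∣ β ∣ *_) (sym (ℕP.*-identityʳ ∣ β ∣)))
    where
    abs-±β² : (m ≡ β ℤ.* β) ⊎ (m ≡ ℤ.- (β ℤ.* β)) → ∣ m ∣ ≡ ∣ β ∣ * ∣ β ∣
    abs-±β² (inj₁ m≡β²)  = trans (cong ∣_∣ m≡β²) (ℤP.abs-* β β)
    abs-±β² (inj₂ m≡-β²) = trans (cong ∣_∣ m≡-β²) (trans (ℤP.∣-i∣≡∣i∣ (β ℤ.* β)) (ℤP.abs-* β β))

  cube⇒power : ∀ {m} → IsCube m → IsPower 3 ∣ m ∣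
  cube⇒power {m} (β , _ , m≡β³) =
    ∣ β ∣ , trans (cong ∣_∣ m≡β³) (trans (ℤP.abs-* (β ℤ.* β) β) (trans (cong (_* ∣ β ∣) (ℤP.abs-* β β)) (cubed ∣ β ∣)))
    where
    cubed : ∀ c → c * c * c ≡ c * (c * (c * 1))
    cubed = ℕ-Solver.solve-∀

  abs-^ : ∀ i n → ∣ i ℤ.^ n ∣ ≡ ∣ i ∣ ^ n
  abs-^ i zero    = refl
  abs-^ i (suc n) = trans (ℤP.abs-* i (i ℤ.^ n)) (cong (∣ i ∣ *_) (abs-^ i n))

  consecutive-abs : ∀ α → α ≢ -[1+ 0 ] → α ≢ + 0 → Consecutive ∣ α ∣ ∣ α ℤ.+ + 1 ∣
  consecutive-abs (+ zero)      _    α≢0 = ⊥-elim (α≢0 refl)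
  consecutive-abs +[1+ a ]      _    _   = subst (λ x → Consecutive (suc a) (suc x)) (ℕP.+-comm 1 a) (ascending (suc a))
  consecutive-abs -[1+ zero ]   α≢-1 _   = ⊥-elim (α≢-1 refl)
  consecutive-abs -[1+ suc b ]  _    _   = descending (suc b)

  module _ (α : ℤ) (α≢-1 : α ≢ -[1+ 0 ]) (α≢0 : α ≢ + 0) where
    open ClosedForm α

    abs-h : ∀ n → ∣ h α n ∣ ≡ ∣ sgn (n % 12) ∣ * (∣ α ∣ ^ E n * ∣ B ∣ ^ F n)
    abs-h n = begin
      ∣ h α n ∣                                              ≡⟨ cong ∣_∣ (h≡closed α≢-1 α≢0 n) ⟩
      ∣ sgn (n % 12) ℤ.* (α ℤ.^ E n ℤ.* B ℤ.^ F n) ∣          ≡⟨ ℤP.abs-* (sgn (n % 12)) _ ⟩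
      ∣ sgn (n % 12) ∣ * ∣ α ℤ.^ E n ℤ.* B ℤ.^ F n ∣          ≡⟨ cong (∣ sgn (n % 12) ∣ *_) (ℤP.abs-* (α ℤ.^ E n) _) ⟩
      ∣ sgn (n % 12) ∣ * (∣ α ℤ.^ E n ∣ * ∣ B ℤ.^ F n ∣)      ≡⟨ cong (∣ sgn (n % 12) ∣ *_) (cong₂ _*_ (abs-^ α (E n)) (abs-^ B (F n))) ⟩
      ∣ sgn (n % 12) ∣ * (∣ α ∣ ^ E n * ∣ B ∣ ^ F n)          ∎
      where open ≡-Reasoning

    h-not-power : ∀ k n (P : ℕ → ℕ → Set) →
      (∀ {a b e f} → Consecutive a b → P e f → ¬ IsPower (suc k) (a ^ e * b ^ f)) →
      ∣ sgn (n % 12) ∣ ≡ 1 × P (E n % suc k) (F n % suc k) → ¬ IsPower (suc k) ∣ h α n ∣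
    h-not-power k n P obstruction (unit-sign , exponents) =
      obstruction pair exponents
      ∘ power-reduce-exponents k ∣ α ∣ ∣ B ∣ (E n) (F n)
          {{proj₁ (consecutive-nonZero pair)}} {{proj₂ (consecutive-nonZero pair)}}
      ∘ subst (IsPower (suc k)) (trans (abs-h n) (trans (cong (_* powers) unit-sign) (ℕP.*-identityˡ powers)))
      where
      powers = ∣ α ∣ ^ E n * ∣ B ∣ ^ F n
      pair = consecutive-abs α α≢-1 α≢0

open PerfectPowers using (NonSquareExponents; consecutive-not-square; NonCubeExponents; consecutive-not-cube)
open Obstructions

theorem5p7 : (α : ℤ) → α ≢ -[1+ 0 ] → α ≢ + 0 →
    ((n : ℕ) → (n % 12 ≡ 2 ⊎ n % 12 ≡ 3 ⊎ n % 12 ≡ 9 ⊎ n % 12 ≡ 10) →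
      ¬ IsSquare (h α n))
    ×
    ((n : ℕ) → (n % 18 ≡ 2 ⊎ n % 18 ≡ 5 ⊎ n % 18 ≡ 7 ⊎ n % 18 ≡ 11 ⊎ n % 18 ≡ 13 ⊎ n % 18 ≡ 16) →
      ¬ IsCube (h α n))
theorem5p7 α α≢-1 α≢0 =
  (λ n residue → h-not-power α α≢-1 α≢0 1 n NonSquareExponents consecutive-not-square (square-exponents n residue)
                   ∘ square⇒power) ,
  (λ n residue → h-not-power α α≢-1 α≢0 2 n NonCubeExponents consecutive-not-cube (cube-exponents n residue)
                   ∘ cube⇒power)
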